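{- For every graph $G$, $B_d^t(G)+B_d^t(G^c)\geq 2$, where $G^c$ is the complement of $G$.
   Context: A total dominator coloring (TD-coloring) of a graph $G$ with no isolated vertex is a proper vertex coloring of $G$ in which every vertex of $G$ is adjacent to every vertex of some (other) color class. The total dominator chromatic (TDC) number $\chi_d^t(G)$ is the minimum number of color classes in a TD-coloring of $G$. The TDC-bondage number $B_d^t(G)$ of $G$ is the minimum number of edges of $G$ whose removal changes the TDC-number of $G$. -}

module Defs where

open import Data.Nat using (ℕ; zero; suc; _+_; _≤_; _<ᵇ_)
open import Data.Fin using (Fin; toℕ; _≟_)
open import Data.Bool using (Bool; true; false; not; _∧_; if_then_else_)
open import Data.List using (List; map; allFin)
open import Data.Nat.ListAction using (sum)
open import Data.Product using (Σ; ∃; ∃-syntax; _×_; _,_)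
open import Relation.Nullary using (¬_; yes; no)
open import Relation.Nullary.Decidable using (⌊_⌋)
open import Relation.Binary.PropositionalEquality using (_≡_; _≢_; refl; sym)

record Graph (n : ℕ) : Set where
  field
    adj    : Fin n → Fin n → Bool
    adj-sym    : ∀ u v → adj u v ≡ adj v u
    adj-irrefl : ∀ v → adj v v ≡ false
open Graph public

Adj : ∀ {n} → Graph n → Fin n → Fin n → Set
Adj G u v = adj G u v ≡ true

private
  eqᵇ-sym : ∀ {n} (u v : Fin n) → ⌊ u ≟ v ⌋ ≡ ⌊ v ≟ u ⌋
  eqᵇ-sym u v with u ≟ v | v ≟ u
  ... | yes _ | yes _ = refl
  ... | yes p | no ¬q = Data.Empty.⊥-elim (¬q (sym p))
    where import Data.Empty
  ... | no ¬p | yes q = Data.Empty.⊥-elim (¬p (sym q))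
    where import Data.Empty
  ... | no _  | no _  = refl

  compAdj : ∀ {n} → Graph n → Fin n → Fin n → Bool
  compAdj G u v = if ⌊ u ≟ v ⌋ then false else not (adj G u v)

  compSym : ∀ {n} (G : Graph n) u v → compAdj G u v ≡ compAdj G v u
  compSym G u v rewrite eqᵇ-sym u v | adj-sym G u v = refl

  compIrr : ∀ {n} (G : Graph n) v → compAdj G v v ≡ false
  compIrr G v with v ≟ v
  ... | yes _ = refl
  ... | no ¬p = Data.Empty.⊥-elim (¬p refl)
    where import Data.Empty

complement : ∀ {n} → Graph n → Graph n
complement G = record
  { adj = compAdj G ; adj-sym = compSym G ; adj-irrefl = compIrr G }

NoIsolated : ∀ {n} → Graph n → Set
NoIsolated {n} G = ∀ (v : Fin n) → ∃[ u ] Adj G v u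

-- A total dominator coloring with exactly k (nonempty) color classes:
-- c is proper, every color is used (so there are exactly k color classes),
-- and every vertex is adjacent to every vertex of some color class
-- (which is then necessarily a class other than its own).
record TDColoring {n} (G : Graph n) (k : ℕ) (c : Fin n → Fin k) : Set where
  field
    proper    : ∀ u v → Adj G u v → c u ≢ c v
    surj      : ∀ (j : Fin k) → ∃[ v ] c v ≡ j
    dominates : ∀ (v : Fin n) → ∃[ j ] (∀ u → c u ≡ j → Adj G v u)

IsTDC : ∀ {n} → Graph n → ℕ → Set
IsTDC {n} G k =
  (∃[ c ] TDColoring G k c) ×
  (∀ (m : ℕ) (c : Fin n → Fin m) → TDColoring G m c → k ≤ m)

-- H is a spanning subgraph of G (i.e. H = G - F for an edge set F ⊆ E(G))
SpanningSub : ∀ {n} → Graph n → Graph n → Set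
SpanningSub H G = ∀ u v → Adj H u v → Adj G u v

-- number of edges of G that are not edges of H (= |F| when H = G - F)
removedCount : ∀ {n} → Graph n → Graph n → ℕ
removedCount {n} G H =
  sum (map (λ u → sum (map (λ v →
        if (toℕ u <ᵇ toℕ v) ∧ adj G u v ∧ not (adj H u v) then 1 else 0)
      (allFin n))) (allFin n))

TDCChanged : ∀ {n} → Graph n → Graph n → Set
TDCChanged G H = ∃[ k ] ∃[ k' ] (IsTDC G k × IsTDC H k' × k ≢ k')

IsTDCBondage : ∀ {n} → Graph n → ℕ → Set
IsTDCBondage {n} G b =
  (∃[ H ] (SpanningSub H G × NoIsolated H × TDCChanged G H × removedCount G H ≡ b)) ×
  (∀ (H : Graph n) → SpanningSub H G → NoIsolated H → TDCChanged G H →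
     b ≤ removedCount G H)

-- Removing no edges leaves the graph, hence its TDC-number, unchanged, so the
-- TDC-bondage number of every graph is at least 1; add this for G and for its complement.
module Submission where

open import Defs
open import Data.Nat using (ℕ; zero; suc; _+_; _≤_; _<_; _<ᵇ_; s≤s; z≤n)
open import Data.Nat.Properties using (m+n≡0⇒m≡0; m+n≡0⇒n≡0; <⇒<ᵇ; <-cmp; ≤-antisym; +-mono-≤)
open import Data.Nat.ListAction using (sum)
open import Data.Fin using (Fin; toℕ)
open import Data.Fin.Properties using (toℕ-injective)
open import Data.List using (List; _∷_; map; allFin)
open import Data.List.Membership.Propositional using (_∈_)
open import Data.List.Membership.Propositional.Properties using (∈-allFin)
open import Data.List.Relation.Unary.Any using (here; there)
open import Data.Bool using (Bool; true; false; not; _∧_; if_then_else_; T)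
open import Data.Empty using (⊥-elim)
open import Data.Product using (_,_)
open import Relation.Binary using (tri<; tri≈; tri>)
open import Relation.Binary.PropositionalEquality using (_≡_; refl; sym; trans)

sum-map≡0⇒≡0 : ∀ {A : Set} (f : A → ℕ) {xs : List A} →
               sum (map f xs) ≡ 0 → ∀ {x} → x ∈ xs → f x ≡ 0
sum-map≡0⇒≡0 f {y ∷ _}  eq (here refl) = m+n≡0⇒m≡0 (f y) eq
sum-map≡0⇒≡0 f {y ∷ ys} eq (there x∈ys) = sum-map≡0⇒≡0 f (m+n≡0⇒n≡0 (f y) eq) x∈ys

uncounted⇒kept : ∀ {a g h : Bool} → T a → g ≡ true →
                 (if a ∧ g ∧ not h then 1 else 0) ≡ 0 → h ≡ true
uncounted⇒kept {true} {h = true}  _ refl _ = refl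
uncounted⇒kept {true} {h = false} _ refl ()

module _ {n : ℕ} (G H : Graph n) (nothing-removed : removedCount G H ≡ 0) where

  private
    removedAt : Fin n → Fin n → ℕ
    removedAt u v = if (toℕ u <ᵇ toℕ v) ∧ adj G u v ∧ not (adj H u v) then 1 else 0

    removedAt≡0 : ∀ u v → removedAt u v ≡ 0
    removedAt≡0 u v =
      sum-map≡0⇒≡0 (removedAt u)
        (sum-map≡0⇒≡0 (λ w → sum (map (removedAt w) (allFin n))) nothing-removed (∈-allFin u))
        (∈-allFin v)

    kept-< : ∀ u v → toℕ u < toℕ v → Adj G u v → Adj H u v
    kept-< u v u<v uv = uncounted⇒kept (<⇒<ᵇ u<v) uv (removedAt≡0 u v)

  removedCount≡0⇒SpanningSub : SpanningSub G H
  removedCount≡0⇒SpanningSub u v uv with <-cmp (toℕ u) (toℕ v)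
  ... | tri< u<v _ _ = kept-< u v u<v uv
  ... | tri> _ _ v<u = trans (adj-sym H u v) (kept-< v u v<u (trans (adj-sym G v u) uv))
  ... | tri≈ _ u≡v _ with toℕ-injective u≡v
  ...   | refl with trans (sym uv) (adj-irrefl G u)
  ...     | ()

TDColoring-transfer : ∀ {n m} {G H : Graph n} {c : Fin n → Fin m} →
                      SpanningSub G H → SpanningSub H G → TDColoring G m c → TDColoring H m c
TDColoring-transfer G⊆H H⊆G tdc = record
  { proper    = λ u v uv → proper u v (H⊆G u v uv)
  ; surj      = surj
  ; dominates = λ v → let (j , dom) = dominates v in j , λ u cu≡j → G⊆H v u (dom u cu≡j)
  }
  where open TDColoring tdc

IsTDC-≤ : ∀ {n k k'} {G H : Graph n} → SpanningSub G H → SpanningSub H G →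
          IsTDC G k → IsTDC H k' → k ≤ k'
IsTDC-≤ G⊆H H⊆G (_ , minimalG) ((c , tdcH) , _) =
  minimalG _ c (TDColoring-transfer H⊆G G⊆H tdcH)

IsTDC-unique : ∀ {n k k'} {G H : Graph n} → SpanningSub G H → SpanningSub H G →
               IsTDC G k → IsTDC H k' → k ≡ k'
IsTDC-unique G⊆H H⊆G tdcG tdcH =
  ≤-antisym (IsTDC-≤ G⊆H H⊆G tdcG tdcH) (IsTDC-≤ H⊆G G⊆H tdcH tdcG)

IsTDCBondage⇒1≤ : ∀ {n b} (G : Graph n) → IsTDCBondage G b → 1 ≤ b
IsTDCBondage⇒1≤ {b = suc _} G _ = s≤s z≤n
IsTDCBondage⇒1≤ {b = zero} G ((H , H⊆G , _ , (_ , _ , tdcG , tdcH , k≢k') , nothing-removed) , _) =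
  ⊥-elim (k≢k' (IsTDC-unique (removedCount≡0⇒SpanningSub G H nothing-removed) H⊆G tdcG tdcH))

theorem4p11 : ∀ (n : ℕ) (G : Graph n) (b b' : ℕ) →
    NoIsolated G → NoIsolated (complement G) →
    IsTDCBondage G b → IsTDCBondage (complement G) b' →
    2 ≤ b + b'
theorem4p11 n G b b' _ _ bondageG bondageGᶜ =
  +-mono-≤ (IsTDCBondage⇒1≤ G bondageG) (IsTDCBondage⇒1≤ (complement G) bondageGᶜ)
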